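{- Let $c:[\mathbb{N}]^2\to\{\text{BLUE},\text{RED}\}$. Suppose $(P^1_b,P^1_r)$ is a one-step path extension of $(P^0_b,P^0_r)$ in which $n$ strongly switches to RED. Then in any sequence of one-step path extensions starting from $(P^1_b,P^1_r)$, $n$ never switches back to BLUE; consequently, for every path extension $(P^2_b,P^2_r)$ of $(P^1_b,P^1_r)$, $n$ lies on $P^2_r$ and the initial segment of $P^2_r$ ending with $n$ equals the initial segment of $P^1_r$ ending with $n$ (the RED path up to $n$ is stable). The symmetric statement with the colors BLUE and RED interchanged also holds.
   Context: A BLUE (RED) path is a finite list of distinct natural numbers in which consecutive elements form a BLUE (RED) pair under $c$; empty and one-element lists are paths of either color. All pairs $(P_b,P_r)$ considered consist of a finite BLUE path and a finite RED path that are disjoint. $(\tilde P_b,\tilde P_r)$ is a one-step path extension of $(P_b,P_r)$ if exactly one of: (1) $\tilde P_b$ is $P_b$ with one element appended and $\tilde P_r=P_r$; (2) $\tilde P_r$ is $P_r$ with one element appended and $\tilde P_b=P_b$; (3) $\tilde P_b$ is $P_b$ with its last element $x_b$ removed and $\tilde P_r$ is $P_r$ with $x_b$ and then some integer $x$ appended (we say $x_b$ switches to RED); (4) $\tilde P_r$ is $P_r$ with its last element $x_r$ removed and $\tilde P_b$ is $P_b$ with $x_r$ and then some integer $x$ appended ($x_r$ switches to BLUE). A path extension of $(P_b,P_r)$ is a pair obtained from it by a finite sequence of one-step path extensions. A BLUE path extension of $(P_b,P_r)$ to $x$ is a path extension $(\tilde P_b,\tilde P_r)$ of $(P_b,P_r)$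 with $\tilde P_r=P_r$ and $x$ the last element of $\tilde P_b$; RED path extension to $x$ is defined symmetrically. In case (3), $x_b$ strongly switches to RED if there is no BLUE path extension of $(P_b,P_r)$ to $x$; in case (4), $x_r$ strongly switches to BLUE if there is no RED path extension of $(P_b,P_r)$ to $x$. -}

module Defs where

open import Data.Nat using (ℕ; _⊓_; _⊔_; _≟_)
open import Data.List using (List; []; _∷_; [_]; _∷ʳ_)
open import Data.List.Relation.Unary.Unique.Propositional using (Unique)
open import Data.List.Relation.Binary.Disjoint.Propositional using (Disjoint)
open import Data.Product using (Σ; ∃; ∃₂; _×_; _,_; proj₁; proj₂)
open import Data.Sum using (_⊎_)
open import Relation.Binary.PropositionalEquality using (_≡_)
open import Relation.Binary.Construct.Closure.ReflexiveTransitive using (Star)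
open import Relation.Nullary using (¬_; yes; no)

data Color : Set where
  BLUE RED : Color

-- A colouring c : [ℕ]^2 → {BLUE,RED}.  We represent it as a function of two
-- arguments and read the colour of the unordered pair {x,y} as c (min) (max);
-- values of c off the strict upper triangle are irrelevant.
Coloring : Set
Coloring = ℕ → ℕ → Color

col : Coloring → ℕ → ℕ → Color
col c x y = c (x ⊓ y) (x ⊔ y)

data Consec (c : Coloring) (k : Color) : List ℕ → Set where
  nil  : Consec c k []
  one  : ∀ x → Consec c k [ x ]
  cons : ∀ {x y xs} → col c x y ≡ k → Consec c k (y ∷ xs) → Consec c k (x ∷ y ∷ xs)

IsPath : Coloring → Color → List ℕ → Set
IsPath c k l = Unique l × Consec c k l

Config : Set
Config = List ℕ × List ℕ

Valid : Coloring → Config → Set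
Valid c (Pb , Pr) = IsPath c BLUE Pb × IsPath c RED Pr × Disjoint Pb Pr

AppendB : Config → Config → Set
AppendB (Pb , Pr) (Qb , Qr) = Σ ℕ λ x → Qb ≡ Pb ∷ʳ x × Qr ≡ Pr

AppendR : Config → Config → Set
AppendR (Pb , Pr) (Qb , Qr) = Σ ℕ λ x → Qr ≡ Pr ∷ʳ x × Qb ≡ Pb

SwitchR : ℕ → ℕ → Config → Config → Set
SwitchR xb x (Pb , Pr) (Qb , Qr) = Pb ≡ Qb ∷ʳ xb × Qr ≡ Pr ∷ʳ xb ∷ʳ x

SwitchB : ℕ → ℕ → Config → Config → Set
SwitchB xr x (Pb , Pr) (Qb , Qr) = Pr ≡ Qr ∷ʳ xr × Qb ≡ Pb ∷ʳ xr ∷ʳ x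

OneStep : Coloring → Config → Config → Set
OneStep c P Q = Valid c P × Valid c Q ×
  (AppendB P Q ⊎ AppendR P Q ⊎ (∃₂ λ xb x → SwitchR xb x P Q) ⊎ (∃₂ λ xr x → SwitchB xr x P Q))

PathExt : Coloring → Config → Config → Set
PathExt c = Star (OneStep c)

BlueExtTo : Coloring → Config → ℕ → Set
BlueExtTo c P x = Σ Config λ Q → PathExt c P Q × proj₂ Q ≡ proj₂ P × ∃ λ l → proj₁ Q ≡ l ∷ʳ x

RedExtTo : Coloring → Config → ℕ → Set
RedExtTo c P x = Σ Config λ Q → PathExt c P Q × proj₁ Q ≡ proj₁ P × ∃ λ l → proj₂ Q ≡ l ∷ʳ x

StronglySwitchesR : Coloring → ℕ → Config → Config → Set
StronglySwitchesR c n P Q = OneStep c P Q × Σ ℕ λ x → SwitchR n x P Q × ¬ BlueExtTo c P x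

StronglySwitchesB : Coloring → ℕ → Config → Config → Set
StronglySwitchesB c n P Q = OneStep c P Q × Σ ℕ λ x → SwitchB n x P Q × ¬ RedExtTo c P x

prefixTo : ℕ → List ℕ → List ℕ
prefixTo n [] = []
prefixTo n (x ∷ xs) with x ≟ n
... | yes _ = [ x ]
... | no _  = x ∷ prefixTo n xs

-- Let n switch strongly to RED, from (A ∷ʳ n , Pr) to (A , Pr ∷ʳ n ∷ʳ x), so
-- that no BLUE path extension of (A ∷ʳ n , Pr) reaches x.  Along any sequence
-- of one-step extensions the RED path keeps the form Pr ++ n ∷ R₀, and x stays
-- linked to n through elements outside A: either x lies on R₀ and everything
-- between n and x is outside A, or x lies on the BLUE path and everything after
-- x on it, as well as all of R₀, is outside A.  Elements that are appended are
-- new, hence outside A, and switches only move elements across this link.  For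
-- n to switch to BLUE, R₀ must be empty, so x is on the BLUE path; then the
-- BLUE segment from x to the newly appended n, read backwards from n, would be a
-- BLUE path extension of (A ∷ʳ n , Pr) to x.  The BLUE statement follows by
-- exchanging the two colours.
module Submission where

open import Defs
open import Data.Nat using (ℕ; _≟_)
open import Data.Nat.Properties using (⊓-comm; ⊔-comm)
open import Data.Product using (Σ; ∃; _×_; _,_; proj₁; proj₂; swap)
open import Data.Sum using (_⊎_; inj₁; inj₂; [_,_]′)
open import Data.Empty using (⊥-elim)
open import Data.List using (List; []; _∷_; [_]; _∷ʳ_; _++_; reverse; initLast; _∷ʳ′_)
open import Data.List.Properties using (++-assoc; ∷ʳ-injective; unfold-reverse; ++-identityʳ; reverse-++)
open import Data.List.Membership.Propositional using (_∈_; _∉_)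
open import Data.List.Membership.Propositional.Properties using (∈-++⁺ˡ; ∈-++⁺ʳ; ∈-++⁻)
open import Data.List.Relation.Unary.Any using (here; there)
import Data.List.Relation.Unary.Any.Properties as Any
open import Data.List.Relation.Unary.All as All using (All; []; _∷_)
import Data.List.Relation.Unary.All.Properties as All
open import Data.List.Relation.Unary.AllPairs using ([]; _∷_)
open import Data.List.Relation.Unary.Unique.Propositional using (Unique)
import Data.List.Relation.Unary.Unique.Propositional.Properties as Unique
open import Data.List.Relation.Binary.Disjoint.Propositional using (Disjoint)
open import Data.List.Relation.Binary.Subset.Propositional using (_⊆_)
open import Data.List.Relation.Binary.Subset.Propositional.Properties
  using (⊆-trans; ⊆-reflexive-↭; xs⊆xs++ys; ++⁺ˡ; ++⁺ʳ)
open import Data.List.Relation.Binary.Permutation.Propositional using (_↭_; ↭-sym; ↭-trans; ↭-reflexive)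
import Data.List.Relation.Binary.Permutation.Propositional.Properties as ↭
import Data.List.Relation.Binary.Permutation.Setoid as SetoidPermutation
import Data.List.Relation.Binary.Permutation.Setoid.Properties as SetoidPermutation
open import Function using (_∘_)
open import Relation.Binary.Construct.Closure.ReflexiveTransitive using (ε; _◅_; gmap)
open import Relation.Binary.PropositionalEquality using (_≡_; refl; sym; trans; cong; cong₂; subst; setoid)
open import Relation.Nullary using (¬_; yes; no)

module _ {a} {X : Set a} where

  ++-∷≡∷ʳ-inversion : ∀ (xs : List X) y ys zs z → xs ++ y ∷ ys ≡ zs ∷ʳ z →
    (ys ≡ [] × y ≡ z × zs ≡ xs) ⊎ (∃ λ ys′ → ys ≡ ys′ ∷ʳ z × zs ≡ xs ++ y ∷ ys′)
  ++-∷≡∷ʳ-inversion xs y ys zs z eq with initLast ys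
  ... | [] with ∷ʳ-injective xs zs eq
  ...   | xs≡zs , y≡z = inj₁ (refl , y≡z , sym xs≡zs)
  ++-∷≡∷ʳ-inversion xs y .(ys′ ∷ʳ w) zs z eq | ys′ ∷ʳ′ w
    with ∷ʳ-injective (xs ++ y ∷ ys′) zs (trans (++-assoc xs (y ∷ ys′) [ w ]) eq)
  ... | zs≡ , refl = inj₂ (ys′ , refl , sym zs≡)

  ++-∷ʳ-∷ʳ : ∀ (xs ys : List X) z w → ((xs ++ ys) ∷ʳ z) ∷ʳ w ≡ xs ++ ((ys ∷ʳ z) ∷ʳ w)
  ++-∷ʳ-∷ʳ xs ys z w = trans (cong (_∷ʳ w) (++-assoc xs ys [ z ])) (++-assoc xs (ys ∷ʳ z) [ w ])

  ∷ʳ-++-↭ : ∀ (xs ys : List X) z → (xs ∷ʳ z) ++ ys ↭ xs ++ (ys ∷ʳ z)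
  ∷ʳ-++-↭ xs ys z = ↭-trans (↭-reflexive (++-assoc xs [ z ] ys)) (↭.++⁺ˡ xs (↭.∷↭∷ʳ z ys))

  ∉-++⁺ : ∀ {x} {xs ys : List X} → x ∉ xs → x ∉ ys → x ∉ xs ++ ys
  ∉-++⁺ {xs = xs} x∉xs x∉ys = [ x∉xs , x∉ys ]′ ∘ ∈-++⁻ xs

  Unique-++⁻ˡ : ∀ (xs : List X) {ys} → Unique (xs ++ ys) → Unique xs
  Unique-++⁻ˡ []       _          = []
  Unique-++⁻ˡ (x ∷ xs) (x∉ ∷ uxs) = All.++⁻ˡ xs x∉ ∷ Unique-++⁻ˡ xs uxs

  Unique-++⁻ʳ : ∀ (xs : List X) {ys} → Unique (xs ++ ys) → Unique ys
  Unique-++⁻ʳ []       u         = u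
  Unique-++⁻ʳ (x ∷ xs) (_ ∷ uxs) = Unique-++⁻ʳ xs uxs

  Unique-++⇒Disjoint : ∀ (xs : List X) {ys} → Unique (xs ++ ys) → Disjoint xs ys
  Unique-++⇒Disjoint (x ∷ xs) (x∉ ∷ _)   (here refl , v∈ys) = All.lookup x∉ (∈-++⁺ʳ xs v∈ys) refl
  Unique-++⇒Disjoint (x ∷ xs) (_ ∷ uxs)  (there v∈xs , v∈ys) = Unique-++⇒Disjoint xs uxs (v∈xs , v∈ys)

  Unique-∷ʳ⇒∉ : ∀ {xs : List X} {x} → Unique (xs ∷ʳ x) → x ∉ xs
  Unique-∷ʳ⇒∉ {xs} u x∈xs = Unique-++⇒Disjoint xs u (x∈xs , here refl)

  Unique-reverse : ∀ {xs : List X} → Unique xs → Unique (reverse xs)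
  Unique-reverse {xs} = SetoidPermutation.Unique-resp-↭ (setoid X)
    (SetoidPermutation.↭-sym (setoid X) (SetoidPermutation.↭-reverse (setoid X) xs))

col-comm : ∀ c x y → col c x y ≡ col c y x
col-comm c x y = cong₂ c (⊓-comm x y) (⊔-comm x y)

module _ {c : Coloring} {k : Color} where

  Consec-++⁻ˡ : ∀ xs {ys} → Consec c k (xs ++ ys) → Consec c k xs
  Consec-++⁻ˡ []           _          = nil
  Consec-++⁻ˡ (x ∷ [])     _          = one x
  Consec-++⁻ˡ (x ∷ y ∷ xs) (cons e r) = cons e (Consec-++⁻ˡ (y ∷ xs) r)

  Consec-tail : ∀ {x xs} → Consec c k (x ∷ xs) → Consec c k xs
  Consec-tail (one _)    = nil
  Consec-tail (cons _ r) = r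

  Consec-++⁻ʳ : ∀ xs {ys} → Consec c k (xs ++ ys) → Consec c k ys
  Consec-++⁻ʳ []       r = r
  Consec-++⁻ʳ (x ∷ xs) r = Consec-++⁻ʳ xs (Consec-tail r)

  Consec-++⁺ : ∀ xs {y ys} → Consec c k (xs ∷ʳ y) → Consec c k (y ∷ ys) → Consec c k (xs ++ y ∷ ys)
  Consec-++⁺ []           _          r = r
  Consec-++⁺ (x ∷ [])     (cons e _) r = cons e r
  Consec-++⁺ (x ∷ x′ ∷ xs) (cons e l) r = cons e (Consec-++⁺ (x′ ∷ xs) l r)

  Consec-reverse : ∀ {xs} → Consec c k xs → Consec c k (reverse xs)
  Consec-reverse nil = nil
  Consec-reverse (one x) = one x
  Consec-reverse (cons {x} {y} {xs} e r) =
    subst (Consec c k) (sym reverse-xyxs)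
      (Consec-++⁺ (reverse xs) reversed-tail (cons (trans (col-comm c y x) e) (one x)))
    where
    reversed-tail : Consec c k (reverse xs ∷ʳ y)
    reversed-tail = subst (Consec c k) (unfold-reverse y xs) (Consec-reverse r)
    reverse-xyxs : reverse (x ∷ y ∷ xs) ≡ reverse xs ++ y ∷ [ x ]
    reverse-xyxs = trans (unfold-reverse x (y ∷ xs))
      (trans (cong (_∷ʳ x) (unfold-reverse y xs)) (++-assoc (reverse xs) [ y ] [ x ]))

  IsPath-++⁻ˡ : ∀ xs {ys} → IsPath c k (xs ++ ys) → IsPath c k xs
  IsPath-++⁻ˡ xs (u , cs) = Unique-++⁻ˡ xs u , Consec-++⁻ˡ xs cs

  IsPath-++⁻ʳ : ∀ xs {ys} → IsPath c k (xs ++ ys) → IsPath c k ys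
  IsPath-++⁻ʳ xs (u , cs) = Unique-++⁻ʳ xs u , Consec-++⁻ʳ xs cs

prefixTo-++-∷ : ∀ {n} (xs : List ℕ) {ys} → n ∉ xs → prefixTo n (xs ++ n ∷ ys) ≡ xs ∷ʳ n
prefixTo-++-∷ {n} [] _ with n ≟ n
... | yes _   = refl
... | no n≢n = ⊥-elim (n≢n refl)
prefixTo-++-∷ {n} (x ∷ xs) n∉ with x ≟ n
... | yes refl = ⊥-elim (n∉ (here refl))
... | no _     = cong (x ∷_) (prefixTo-++-∷ xs (n∉ ∘ there))

Elems : Config → List ℕ
Elems (B , R) = B ++ R

module _ {c : Coloring} where

  Valid-++⁻ˡ : ∀ xs {ys R} → Valid c (xs ++ ys , R) → Valid c (xs , R)
  Valid-++⁻ˡ xs (blue , red , disjoint) =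
    IsPath-++⁻ˡ xs blue , red , λ { (p , q) → disjoint (∈-++⁺ˡ p , q) }

  PathExt-++-blue : ∀ xs ys R → Valid c (xs ++ ys , R) → PathExt c (xs , R) (xs ++ ys , R)
  PathExt-++-blue xs []       R V rewrite ++-identityʳ xs = ε
  PathExt-++-blue xs (y ∷ ys) R V =
    (Valid-++⁻ˡ xs V , Valid-++⁻ˡ (xs ∷ʳ y) V′ , inj₁ (y , refl , refl)) ◅
    subst (λ B → PathExt c (xs ∷ʳ y , R) (B , R)) assoc (PathExt-++-blue (xs ∷ʳ y) ys R V′)
    where
    assoc : (xs ∷ʳ y) ++ ys ≡ xs ++ y ∷ ys
    assoc = ++-assoc xs [ y ] ys
    V′ : Valid c ((xs ∷ʳ y) ++ ys , R)
    V′ = subst (λ B → Valid c (B , R)) (sym assoc) V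

  Valid-reverse-detour : ∀ {A R D n} → Valid c (A ∷ʳ n , R) → IsPath c BLUE (D ∷ʳ n) →
    All (_∉ A) D → Disjoint D R → Valid c ((A ∷ʳ n) ++ reverse D , R)
  Valid-reverse-detour {A} {R} {D} {n} ((uA , cA) , red , disjointA) (uD , cD) D∉A disjointD =
    (Unique.++⁺ uA (Unique-reverse (Unique-++⁻ˡ D uD)) disjoint , consec) , red , disjointR
    where
    disjoint : Disjoint (A ∷ʳ n) (reverse D)
    disjoint (p , q) with ∈-++⁻ A p
    ... | inj₁ z∈A         = All.lookup D∉A (Any.reverse⁻ q) z∈A
    ... | inj₂ (here refl) = Unique-∷ʳ⇒∉ uD (Any.reverse⁻ q)
    consec : Consec c BLUE ((A ∷ʳ n) ++ reverse D)
    consec = subst (Consec c BLUE) (sym (++-assoc A [ n ] (reverse D)))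
      (Consec-++⁺ A cA (subst (Consec c BLUE) (reverse-++ D [ n ]) (Consec-reverse cD)))
    disjointR : Disjoint ((A ∷ʳ n) ++ reverse D) R
    disjointR (p , q) =
      [ (λ p′ → disjointA (p′ , q)) , (λ p′ → disjointD (Any.reverse⁻ p′ , q)) ]′ (∈-++⁻ (A ∷ʳ n) p)

  BlueExtTo-reverse-detour : ∀ {A R x D n} → Valid c (A ∷ʳ n , R) → IsPath c BLUE ((x ∷ D) ∷ʳ n) →
    All (_∉ A) (x ∷ D) → Disjoint (x ∷ D) R → BlueExtTo c (A ∷ʳ n , R) x
  BlueExtTo-reverse-detour {A} {R} {x} {D} {n} V path D∉A disjointD =
    (_ , R) , PathExt-++-blue (A ∷ʳ n) (reverse (x ∷ D)) R (Valid-reverse-detour V path D∉A disjointD) ,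
    refl , (A ∷ʳ n) ++ reverse D , ends-in-x
    where
    ends-in-x : (A ∷ʳ n) ++ reverse (x ∷ D) ≡ ((A ∷ʳ n) ++ reverse D) ∷ʳ x
    ends-in-x = trans (cong ((A ∷ʳ n) ++_) (unfold-reverse x D)) (sym (++-assoc (A ∷ʳ n) (reverse D) [ x ]))

  OneStep⇒⊆ : ∀ {P Q} → OneStep c P Q → Elems P ⊆ Elems Q
  OneStep⇒⊆ {B , R} (_ , _ , inj₁ (y , refl , refl)) = ++⁺ˡ R (xs⊆xs++ys B [ y ])
  OneStep⇒⊆ {B , R} (_ , _ , inj₂ (inj₁ (y , refl , refl))) = ++⁺ʳ B (xs⊆xs++ys R [ y ])
  OneStep⇒⊆ {_ , R} {B , _} (_ , _ , inj₂ (inj₂ (inj₁ (z , y , refl , refl)))) =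
    ⊆-trans (⊆-reflexive-↭ (∷ʳ-++-↭ B R z)) (++⁺ʳ B (xs⊆xs++ys (R ∷ʳ z) [ y ]))
  OneStep⇒⊆ {B , _} {_ , R} (_ , _ , inj₂ (inj₂ (inj₂ (z , y , refl , refl)))) =
    ⊆-trans (⊆-reflexive-↭ (↭-sym (∷ʳ-++-↭ B R z))) (++⁺ˡ R (xs⊆xs++ys (B ∷ʳ z) [ y ]))

  ∉-appendBlue : ∀ {B R y} → Valid c (B ∷ʳ y , R) → y ∉ B ++ R
  ∉-appendBlue {B} ((u , _) , _ , disjoint) =
    ∉-++⁺ (Unique-∷ʳ⇒∉ u) (λ q → disjoint (∈-++⁺ʳ B (here refl) , q))

  ∉-appendRed : ∀ {B R y} → Valid c (B , R ∷ʳ y) → y ∉ B ++ R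
  ∉-appendRed {R = R} (_ , (u , _) , disjoint) =
    ∉-++⁺ (λ p → disjoint (p , ∈-++⁺ʳ R (here refl))) (Unique-∷ʳ⇒∉ u)

  ∉-switchRed : ∀ {B R z y} → Valid c (B , (R ∷ʳ z) ∷ʳ y) → y ∉ (B ∷ʳ z) ++ R
  ∉-switchRed {B} {R} {z} V = ∉-appendRed V ∘ ⊆-reflexive-↭ (∷ʳ-++-↭ B R z)

  ∉-switchBlue : ∀ {B R z y} → Valid c ((B ∷ʳ z) ∷ʳ y , R) → y ∉ B ++ (R ∷ʳ z)
  ∉-switchBlue {B} {R} {z} V = ∉-appendBlue V ∘ ⊆-reflexive-↭ (↭-sym (∷ʳ-++-↭ B R z))

NeverSwitchesToBlue : Coloring → ℕ → Config → Set
NeverSwitchesToBlue c n P₁ =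
  ∀ P₂ P₃ → PathExt c P₁ P₂ → OneStep c P₂ P₃ → ¬ (Σ ℕ λ y → SwitchB n y P₂ P₃)

NeverSwitchesToRed : Coloring → ℕ → Config → Set
NeverSwitchesToRed c n P₁ =
  ∀ P₂ P₃ → PathExt c P₁ P₂ → OneStep c P₂ P₃ → ¬ (Σ ℕ λ y → SwitchR n y P₂ P₃)

RedPrefixStable : Coloring → ℕ → Config → Set
RedPrefixStable c n P₁ =
  ∀ P₂ → PathExt c P₁ P₂ → (n ∈ proj₂ P₂) × (prefixTo n (proj₂ P₂) ≡ prefixTo n (proj₂ P₁))

BluePrefixStable : Coloring → ℕ → Config → Set
BluePrefixStable c n P₁ =
  ∀ P₂ → PathExt c P₁ P₂ → (n ∈ proj₁ P₂) × (prefixTo n (proj₁ P₂) ≡ prefixTo n (proj₁ P₁))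

module RedStability (c : Coloring) (n x : ℕ) (A Pr : List ℕ)
  (V₀ : Valid c (A ∷ʳ n , Pr)) (x∉A : x ∉ A) (noBlueExt : ¬ BlueExtTo c (A ∷ʳ n , Pr) x) where

  data XPosition (B R₀ : List ℕ) : Set where
    onRed  : ∀ F R₁ → R₀ ≡ F ++ x ∷ R₁ → All (_∉ A) F → XPosition B R₀
    onBlue : ∀ B₁ B₂ → B ≡ B₁ ++ x ∷ B₂ → All (_∉ A) B₂ → All (_∉ A) R₀ → XPosition B R₀

  XPosition-appendBlue : ∀ {B R₀ y} → y ∉ A → XPosition B R₀ → XPosition (B ∷ʳ y) R₀
  XPosition-appendBlue y∉A (onRed F R₁ eq F∉A) = onRed F R₁ eq F∉A
  XPosition-appendBlue {y = y} y∉A (onBlue B₁ B₂ refl B₂∉A R₀∉A) =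
    onBlue B₁ (B₂ ∷ʳ y) (++-assoc B₁ (x ∷ B₂) [ y ]) (All.∷ʳ⁺ B₂∉A y∉A) R₀∉A

  XPosition-appendRed : ∀ {B R₀ y} → y ∉ A → XPosition B R₀ → XPosition B (R₀ ∷ʳ y)
  XPosition-appendRed {y = y} y∉A (onRed F R₁ refl F∉A) =
    onRed F (R₁ ∷ʳ y) (++-assoc F (x ∷ R₁) [ y ]) F∉A
  XPosition-appendRed y∉A (onBlue B₁ B₂ eq B₂∉A R₀∉A) = onBlue B₁ B₂ eq B₂∉A (All.∷ʳ⁺ R₀∉A y∉A)

  XPosition-switchRed : ∀ {B R₀ z y} → y ∉ A → XPosition (B ∷ʳ z) R₀ → XPosition B ((R₀ ∷ʳ z) ∷ʳ y)
  XPosition-switchRed {z = z} {y} y∉A (onRed F R₁ refl F∉A) =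
    onRed F ((R₁ ∷ʳ z) ∷ʳ y) (++-∷ʳ-∷ʳ F (x ∷ R₁) z y) F∉A
  XPosition-switchRed {B} {R₀} {z} {y} y∉A (onBlue B₁ B₂ eq B₂∉A R₀∉A)
    with ++-∷≡∷ʳ-inversion B₁ x B₂ B z (sym eq)
  ... | inj₁ (_ , refl , _) = onRed R₀ [ y ] (++-assoc R₀ [ x ] [ y ]) R₀∉A
  ... | inj₂ (B₂′ , refl , B≡) with All.∷ʳ⁻ B₂∉A
  ...   | B₂′∉A , z∉A = onBlue B₁ B₂′ B≡ B₂′∉A (All.∷ʳ⁺ (All.∷ʳ⁺ R₀∉A z∉A) y∉A)

  XPosition-switchBlue : ∀ {B R₀ z y} → y ∉ A → XPosition B (R₀ ∷ʳ z) → XPosition ((B ∷ʳ z) ∷ʳ y) R₀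
  XPosition-switchBlue {B} {R₀} {z} {y} y∉A (onRed F R₁ eq F∉A)
    with ++-∷≡∷ʳ-inversion F x R₁ R₀ z (sym eq)
  ... | inj₁ (_ , refl , refl) = onBlue B [ y ] (++-assoc B [ x ] [ y ]) (y∉A ∷ []) F∉A
  ... | inj₂ (R₁′ , _ , R₀≡) = onRed F R₁′ R₀≡ F∉A
  XPosition-switchBlue {z = z} {y} y∉A (onBlue B₁ B₂ refl B₂∉A R₀z∉A) with All.∷ʳ⁻ R₀z∉A
  ... | R₀∉A , z∉A =
    onBlue B₁ ((B₂ ∷ʳ z) ∷ʳ y) (++-∷ʳ-∷ʳ B₁ (x ∷ B₂) z y) (All.∷ʳ⁺ (All.∷ʳ⁺ B₂∉A z∉A) y∉A) R₀∉A

  n-stays-red : ∀ {B y} → XPosition B [] → ¬ Valid c ((B ∷ʳ n) ∷ʳ y , Pr)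
  n-stays-red (onRed [] _ () _)
  n-stays-red (onRed (_ ∷ _) _ () _)
  n-stays-red {y = y} (onBlue B₁ B₂ refl B₂∉A _) (blue , _ , disjoint) =
    noBlueExt (BlueExtTo-reverse-detour V₀ detour (x∉A ∷ B₂∉A) λ { (p , q) → disjoint (on-blue p , q) })
    where
    detour : IsPath c BLUE ((x ∷ B₂) ∷ʳ n)
    detour = IsPath-++⁻ʳ B₁ (subst (IsPath c BLUE) (++-assoc B₁ (x ∷ B₂) [ n ])
      (IsPath-++⁻ˡ ((B₁ ++ x ∷ B₂) ∷ʳ n) blue))
    on-blue : ∀ {v} → v ∈ x ∷ B₂ → v ∈ ((B₁ ++ x ∷ B₂) ∷ʳ n) ∷ʳ y
    on-blue = ∈-++⁺ˡ ∘ ∈-++⁺ˡ ∘ ∈-++⁺ʳ B₁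

  n∉Pr : n ∉ Pr
  n∉Pr p = proj₂ (proj₂ V₀) (∈-++⁺ʳ A (here refl) , p)

  Shape : Config → Set
  Shape (B , R) = Σ (List ℕ) λ R₀ → R ≡ Pr ++ n ∷ R₀ × XPosition B R₀

  Shape⇒prefixTo : ∀ {P} → Shape P → (n ∈ proj₂ P) × (prefixTo n (proj₂ P) ≡ Pr ∷ʳ n)
  Shape⇒prefixTo {_ , _} (_ , refl , _) = ∈-++⁺ʳ Pr (here refl) , prefixTo-++-∷ Pr n∉Pr

  Shape-step : ∀ {P Q} → (∀ {y} → y ∉ Elems P → y ∉ A) → Shape P → OneStep c P Q → Shape Q
  Shape-step {_ , _} new (R₀ , refl , pos) (_ , V , inj₁ (_ , refl , refl)) =
    R₀ , refl , XPosition-appendBlue (new (∉-appendBlue V)) pos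
  Shape-step {_ , _} new (R₀ , refl , pos) (_ , V , inj₂ (inj₁ (y , refl , refl))) =
    R₀ ∷ʳ y , ++-assoc Pr (n ∷ R₀) [ y ] , XPosition-appendRed (new (∉-appendRed V)) pos
  Shape-step {_ , _} new (R₀ , refl , pos) (_ , V , inj₂ (inj₂ (inj₁ (z , y , refl , refl)))) =
    (R₀ ∷ʳ z) ∷ʳ y , ++-∷ʳ-∷ʳ Pr (n ∷ R₀) z y , XPosition-switchRed (new (∉-switchRed V)) pos
  Shape-step {B , _} {_ , R′} new (R₀ , refl , pos) (_ , V , inj₂ (inj₂ (inj₂ (z , y , R≡ , refl))))
    with ++-∷≡∷ʳ-inversion Pr n R₀ R′ z R≡
  ... | inj₁ (refl , refl , refl) = ⊥-elim (n-stays-red pos V)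
  ... | inj₂ (R₀′ , refl , refl) = R₀′ , refl , XPosition-switchBlue (new y∉) pos
    where
    y∉ : y ∉ B ++ (Pr ++ n ∷ (R₀′ ∷ʳ z))
    y∉ = ∉-switchBlue V ∘ subst (_ ∈_) (cong (B ++_) (sym (++-assoc Pr (n ∷ R₀′) [ z ])))

  Stable : Config → Set
  Stable P = A ⊆ Elems P × Shape P

  Stable-initial : Stable (A , (Pr ∷ʳ n) ∷ʳ x)
  Stable-initial = xs⊆xs++ys A _ , [ x ] , ++-assoc Pr [ n ] [ x ] , onRed [] [] refl []

  Stable-star : ∀ {P Q} → Stable P → PathExt c P Q → Stable Q
  Stable-star st ε = st
  Stable-star (covers , shape) (s ◅ ss) =
    Stable-star (⊆-trans covers (OneStep⇒⊆ s) , Shape-step (λ y∉ → y∉ ∘ covers) shape s) ss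

  never-switches-to-blue : NeverSwitchesToBlue c n (A , (Pr ∷ʳ n) ∷ʳ x)
  never-switches-to-blue (_ , _) (_ , R′) e (VP , VQ , _) (_ , R≡ , refl)
    with proj₂ (Stable-star Stable-initial e)
  ... | R₀ , refl , pos with ++-∷≡∷ʳ-inversion Pr n R₀ R′ n R≡
  ...   | inj₁ (refl , _ , refl) = n-stays-red pos VQ
  ...   | inj₂ (R₀′ , refl , _) with Unique-++⁻ʳ Pr (proj₁ (proj₁ (proj₂ VP)))
  ...     | n∉R₀′n ∷ _ = All.lookup n∉R₀′n (∈-++⁺ʳ R₀′ (here refl)) refl

  red-prefix-stable : RedPrefixStable c n (A , (Pr ∷ʳ n) ∷ʳ x)
  red-prefix-stable P₂ e with Shape⇒prefixTo (proj₂ (Stable-star Stable-initial e))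
  ... | n∈ , prefix≡ = n∈ , trans prefix≡ (sym (proj₂ (Shape⇒prefixTo (proj₂ Stable-initial))))

stronglySwitchesR⇒stable : ∀ c n P₀ P₁ → StronglySwitchesR c n P₀ P₁ →
  NeverSwitchesToBlue c n P₁ × RedPrefixStable c n P₁
stronglySwitchesR⇒stable c n (_ , Pr) (A , _) ((V₀ , (_ , _ , disjoint) , _) , x , (refl , refl) , noBlueExt) =
  never-switches-to-blue , red-prefix-stable
  where
  open RedStability c n x A Pr V₀ (λ p → disjoint (p , ∈-++⁺ʳ (Pr ∷ʳ n) (here refl))) noBlueExt

invert : Color → Color
invert BLUE = RED
invert RED  = BLUE

invert-involutive : ∀ k → invert (invert k) ≡ k
invert-involutive BLUE = refl
invert-involutive RED  = refl

inverted : Coloring → Coloring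
inverted c a b = invert (c a b)

module ColourSwap (c d : Coloring) (d≡invert-c : ∀ a b → d a b ≡ invert (c a b)) where

  Consec-swap : ∀ {k l} → Consec c k l → Consec d (invert k) l
  Consec-swap nil        = nil
  Consec-swap (one x)    = one x
  Consec-swap (cons e r) = cons (trans (d≡invert-c _ _) (cong invert e)) (Consec-swap r)

  Valid-swap : ∀ {P} → Valid c P → Valid d (swap P)
  Valid-swap ((ub , cb) , (ur , cr) , disjoint) =
    (ur , Consec-swap cr) , (ub , Consec-swap cb) , disjoint ∘ swap

  OneStep-swap : ∀ {P Q} → OneStep c P Q → OneStep d (swap P) (swap Q)
  OneStep-swap (VP , VQ , inj₁ m)               = Valid-swap VP , Valid-swap VQ , inj₂ (inj₁ m)
  OneStep-swap (VP , VQ , inj₂ (inj₁ m))        = Valid-swap VP , Valid-swap VQ , inj₁ m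
  OneStep-swap (VP , VQ , inj₂ (inj₂ (inj₁ m))) = Valid-swap VP , Valid-swap VQ , inj₂ (inj₂ (inj₂ m))
  OneStep-swap (VP , VQ , inj₂ (inj₂ (inj₂ m))) = Valid-swap VP , Valid-swap VQ , inj₂ (inj₂ (inj₁ m))

  PathExt-swap : ∀ {P Q} → PathExt c P Q → PathExt d (swap P) (swap Q)
  PathExt-swap = gmap swap OneStep-swap

stronglySwitchesB⇒stable : ∀ c n P₀ P₁ → StronglySwitchesB c n P₀ P₁ →
  NeverSwitchesToRed c n P₁ × BluePrefixStable c n P₁
stronglySwitchesB⇒stable c n P₀ P₁ (s , x , switch , noRedExt) =
  (λ P₂ P₃ e s′ → proj₁ swapped (swap P₂) (swap P₃) (To.PathExt-swap e) (To.OneStep-swap s′)) ,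
  (λ P₂ e → proj₂ swapped (swap P₂) (To.PathExt-swap e))
  where
  module To   = ColourSwap c (inverted c) (λ _ _ → refl)
  module From = ColourSwap (inverted c) c (λ a b → sym (invert-involutive (c a b)))
  noBlueExt : ¬ BlueExtTo (inverted c) (swap P₀) x
  noBlueExt (Q , e , red≡ , l , blue≡) = noRedExt (swap Q , From.PathExt-swap e , red≡ , l , blue≡)
  swapped : NeverSwitchesToBlue (inverted c) n (swap P₁) × RedPrefixStable (inverted c) n (swap P₁)
  swapped = stronglySwitchesR⇒stable (inverted c) n (swap P₀) (swap P₁)
    (To.OneStep-swap s , x , switch , noBlueExt)

lemma4 : (c : Coloring) (n : ℕ) →
    (∀ P0 P1 → StronglySwitchesR c n P0 P1 →
      (∀ P2 P3 → PathExt c P1 P2 → OneStep c P2 P3 → ¬ (Σ ℕ λ y → SwitchB n y P2 P3))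
      × (∀ P2 → PathExt c P1 P2 → (n ∈ proj₂ P2) × (prefixTo n (proj₂ P2) ≡ prefixTo n (proj₂ P1))))
    × (∀ P0 P1 → StronglySwitchesB c n P0 P1 →
      (∀ P2 P3 → PathExt c P1 P2 → OneStep c P2 P3 → ¬ (Σ ℕ λ y → SwitchR n y P2 P3))
      × (∀ P2 → PathExt c P1 P2 → (n ∈ proj₁ P2) × (prefixTo n (proj₁ P2) ≡ prefixTo n (proj₁ P1))))
lemma4 c n = stronglySwitchesR⇒stable c n , stronglySwitchesB⇒stable c n
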